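{- Let $P$ be an $N$-element poset, let $x\in P$, and let $X=\{y\in P: y<_P x\}$. Suppose that every element of $P$ that is comparable with some element of $X$ is also comparable with $x$. Then for every labeling $L$ of $P$ and every $\gamma\ge0$, the set $\partial^\gamma(L)(X)$ depends only on the set $L(X)$ and the restriction $L|_{P\setminus X}$; that is, if $\widetilde L$ is a labeling of $P$ with $\widetilde L|_{P\setminus X}=L|_{P\setminus X}$, then $\partial^\gamma(\widetilde L)(X)=\partial^\gamma(L)(X)$.
   Context: A labeling of an $N$-element poset $P$ is a bijection $L:P\to[N]$. For a labeling $L$ and a non-maximal $x$, the $L$-successor of $x$ is the element $y>_P x$ minimizing $L(y)$. The promotion chain of $L$ is $v_1<_P\cdots<_P v_m$ with $v_1=L^{ -1}(1)$, $v_{i+1}$ the $L$-successor of $v_i$ while $v_i$ is not maximal, and $v_m$ maximal. Extended promotion: $\partial(L)(z)=L(z)-1$ for $z$ not in the chain, $\partial(L)(v_i)=L(v_{i+1})-1$ for $i<m$, $\partial(L)(v_m)=N$. -}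

module Defs where

open import Data.Nat using (ℕ; zero; suc; _∸_; _≤_; _<ᵇ_)
import Data.Nat
open import Data.Fin using (Fin)
open import Data.Fin.Properties using (_≟_)
open import Data.List using (List; []; _∷_; filterᵇ; allFin)
open import Data.Maybe using (Maybe; just; nothing)
open import Data.Bool using (Bool; true; false; if_then_else_)
open import Data.Product using (Σ; _×_; _,_)
open import Data.Sum using (_⊎_)
open import Relation.Binary.PropositionalEquality using (_≡_)
open import Relation.Binary.Core using (Rel)
open import Relation.Binary.Structures using (IsStrictPartialOrder)
open import Relation.Binary.Definitions using (Decidable)
open import Relation.Nullary.Decidable using (⌊_⌋)
open import Function.Definitions using (Injective)
open import Relation.Nullary using (¬_)

-- A finite poset on the N-element set Fin N, given by its strict order
-- (decidable, so that the promotion operator can be computed).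
record FinPoset (N : ℕ) : Set₁ where
  field
    _<ₚ_ : Rel (Fin N) _
    isStrictPartialOrder : IsStrictPartialOrder _≡_ _<ₚ_
    _<ₚ?_ : Decidable _<ₚ_

Comparable : ∀ {N} (P : FinPoset N) → Fin N → Fin N → Set
Comparable P y z = y ≡ z ⊎ (y <ₚ z ⊎ z <ₚ y)
  where open FinPoset P

IsLabeling : ∀ {N} → (Fin N → ℕ) → Set
IsLabeling {N} L =
  Injective _≡_ _≡_ L
  × (∀ z → 1 ≤ L z × L z ≤ N)
  × (∀ k → 1 ≤ k → k ≤ N → Σ (Fin N) λ z → L z ≡ k)

module _ {N : ℕ} (P : FinPoset N) where
  open FinPoset P

  argmin : (Fin N → ℕ) → List (Fin N) → Maybe (Fin N)
  argmin L [] = nothing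
  argmin L (y ∷ ys) with argmin L ys
  ... | nothing = just y
  ... | just w = if L w <ᵇ L y then just w else just y

  successor : (Fin N → ℕ) → Fin N → Maybe (Fin N)
  successor L x = argmin L (filterᵇ (λ y → ⌊ x <ₚ? y ⌋) (allFin N))

  labelOne : (Fin N → ℕ) → Maybe (Fin N)
  labelOne L = argmin L (filterᵇ (λ y → ⌊ L y Data.Nat.≟ 1 ⌋) (allFin N))

  chainFrom : (Fin N → ℕ) → ℕ → Fin N → List (Fin N)
  chainFrom L zero v = v ∷ []
  chainFrom L (suc k) v with successor L v
  ... | nothing = v ∷ []
  ... | just w = v ∷ chainFrom L k w

  -- the promotion chain v₁ < … < vₘ of L (fuel N suffices for a labeling,
  -- since labels strictly increase along the chain)
  promotionChain : (Fin N → ℕ) → List (Fin N)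
  promotionChain L with labelOne L
  ... | nothing = []
  ... | just v = chainFrom L N v

  inList : Fin N → List (Fin N) → Bool
  inList z [] = false
  inList z (y ∷ ys) = if ⌊ z ≟ y ⌋ then true else inList z ys

  promotion : (Fin N → ℕ) → (Fin N → ℕ)
  promotion L z with inList z (promotionChain L)
  ... | false = L z ∸ 1
  ... | true with successor L z
  ...   | just w = L w ∸ 1
  ...   | nothing = N

  promotion^ : ℕ → (Fin N → ℕ) → (Fin N → ℕ)
  promotion^ zero L = L
  promotion^ (suc γ) L = promotion (promotion^ γ L)

¬X : ∀ {N} (P : FinPoset N) → Fin N → Fin N → Set
¬X P x z = ¬ (FinPoset._<ₚ_ P z x)

-- Let v₁ < ⋯ < vₘ be the promotion chain of a labeling L. Then ∂L = rotate N ∘ L ∘ c, where c is the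
-- cyclic permutation v₁ ↦ v₂ ↦ ⋯ ↦ vₘ ↦ v₁ fixing every other element and rotate N sends 1 ↦ N and
-- k ↦ k − 1; hence ∂ maps labelings to labelings. Two labelings that agree off X take the same set of
-- values on X, so by induction on γ it suffices to show that ∂ preserves agreement off X. Since P ∖ X is
-- an up-set, successors of elements off X only see labels off X. A chain starting in X leaves X at the
-- label-minimal element of {y : x ≤ y}, because by hypothesis every element outside X above a point of X
-- lies above x; this element is the same for both labelings. So both promotion chains meet P ∖ X in the
-- same elements, with the same successors there.

module Submission where

open import Defs
open import Data.Nat using (ℕ; zero; suc; _∸_; _≤_; _<_; z≤n; s≤s)
open import Data.Nat.Properties using (<-≤-trans; ≤-pred; n≮0; <ᵇ-reflects-<; <⇒≤; ≮⇒≥; ≤-refl; ≤-trans; ≤-reflexive; ≤-antisym; <-irrefl; n≤1+n; ≤∧≢⇒<)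
import Data.Nat as ℕ
open import Data.Fin using (Fin; fromℕ<)
open import Data.Fin.Properties using (_≟_)
open import Data.List using (List; []; _∷_; filter; filterᵇ; allFin; length)
open import Data.List.Properties using (filter-notAll; filter-reject; length-filter; length-tabulate)
open import Data.List.Membership.Propositional using (_∈_)
open import Data.List.Membership.Propositional.Properties using (∈-allFin; ∈-filter⁺; ∈-filter⁻; ∉[])
open import Data.List.Relation.Unary.Any using (here; there)
import Data.List.Relation.Unary.Any as Any
open import Data.Maybe using (just; nothing)
open import Data.Maybe.Properties using (just-injective)
open import Data.Bool using (true; false)
open import Data.Product using (Σ; _×_; _,_; proj₁; proj₂)
open import Data.Sum using (_⊎_; inj₁; inj₂)
open import Data.Empty using (⊥-elim)
open import Function using (_∘_; id; case_of_)
open import Function.Bundles using (_⇔_; mk⇔)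
open import Relation.Binary.PropositionalEquality using (_≡_; _≢_; _≗_; refl; sym; trans; cong; subst; subst₂; module ≡-Reasoning)
open import Relation.Binary.Structures using (IsStrictPartialOrder)
open import Relation.Binary.Construct.Closure.ReflexiveTransitive using (Star; ε; _◅_; _◅◅_)
open import Relation.Nullary using (¬_; yes; no; ofʸ; ofⁿ)
open import Relation.Nullary.Decidable using (⌊_⌋; T?; toWitness; fromWitness)
import Relation.Unary as U

module _ {A : Set} {P Q : A → Set} (P? : U.Decidable P) (Q? : U.Decidable Q)
         (P⇒Q : ∀ {y} → P y → Q y) where

  filter-absorb : ∀ xs → filter P? (filter Q? xs) ≡ filter P? xs
  filter-absorb [] = refl
  filter-absorb (x ∷ xs) with Q? x
  ... | no ¬qx = trans (filter-absorb xs) (sym (filter-reject P? (¬qx ∘ P⇒Q)))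
  ... | yes _ with P? x
  ...   | yes _ = cong (x ∷_) (filter-absorb xs)
  ...   | no _  = filter-absorb xs

  length-filter-< : ∀ {x xs} → x ∈ xs → Q x → ¬ P x →
                    length (filter P? xs) < length (filter Q? xs)
  length-filter-< {x} {xs} x∈xs qx ¬px =
    subst (λ ys → length ys < length (filter Q? xs)) (filter-absorb xs)
      (filter-notAll P? (filter Q? xs) (Any.map (λ { refl → ¬px }) (∈-filter⁺ Q? x∈xs qx)))

module _ {A : Set} {Q : A → Set} (Q? : U.Decidable Q) where

  ∈-filterᵇ⁺ : ∀ {x xs} → x ∈ xs → Q x → x ∈ filterᵇ (λ y → ⌊ Q? y ⌋) xs
  ∈-filterᵇ⁺ x∈xs qx = ∈-filter⁺ (T? ∘ λ y → ⌊ Q? y ⌋) x∈xs (fromWitness qx)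

  ∈-filterᵇ⁻ : ∀ {x} xs → x ∈ filterᵇ (λ y → ⌊ Q? y ⌋) xs → Q x
  ∈-filterᵇ⁻ xs x∈ = toWitness (proj₂ (∈-filter⁻ (T? ∘ λ y → ⌊ Q? y ⌋) {xs = xs} x∈))

-- A cyclic permutation of {1, …, n}; the value at 0 is junk.
rotate : ℕ → ℕ → ℕ
rotate n (suc zero) = n
rotate n k = k ∸ 1

rotate-≢1 : ∀ n {k} → k ≢ 1 → rotate n k ≡ k ∸ 1
rotate-≢1 n {zero} _ = refl
rotate-≢1 n {suc zero} k≢1 = ⊥-elim (k≢1 refl)
rotate-≢1 n {suc (suc k)} _ = refl

rotate-bounded : ∀ {n k} → 1 ≤ k × k ≤ n → 1 ≤ rotate n k × rotate n k ≤ n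
rotate-bounded {k = suc zero} (_ , 1≤n) = 1≤n , ≤-refl
rotate-bounded {k = suc (suc k)} (_ , k+2≤n) = s≤s z≤n , ≤-trans (n≤1+n _) k+2≤n

rotate-injective : ∀ {n j k} → 1 ≤ j × j ≤ n → 1 ≤ k × k ≤ n → rotate n j ≡ rotate n k → j ≡ k
rotate-injective {j = suc zero} {suc zero} _ _ _ = refl
rotate-injective {j = suc zero} {suc (suc k)} _ (_ , k+2≤n) refl = ⊥-elim (<-irrefl refl k+2≤n)
rotate-injective {j = suc (suc j)} {suc zero} (_ , j+2≤n) _ refl = ⊥-elim (<-irrefl refl j+2≤n)
rotate-injective {j = suc (suc j)} {suc (suc k)} _ _ eq = cong suc eq

rotate-surjective : ∀ {n m} → 1 ≤ m × m ≤ n → Σ ℕ λ k → (1 ≤ k × k ≤ n) × rotate n k ≡ m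
rotate-surjective {n} {m} (1≤m , _) with m ℕ.≟ n
... | yes refl = 1 , (≤-refl , 1≤m) , refl
rotate-surjective {n} {suc m} (_ , m<n) | no m≢n = suc (suc m) , (s≤s z≤n , ≤∧≢⇒< m<n m≢n) , refl

module _ {N : ℕ} where

  IsLabeling-resp-≗ : ∀ {L L′ : Fin N → ℕ} → L ≗ L′ → IsLabeling L → IsLabeling L′
  IsLabeling-resp-≗ L≗L′ (inj , bounds , onto) =
    (λ eq → inj (trans (L≗L′ _) (trans eq (sym (L≗L′ _)))))
    , (λ z → subst (λ k → 1 ≤ k × k ≤ N) (L≗L′ z) (bounds z))
    , (λ k 1≤k k≤N → let z , Lz≡k = onto k 1≤k k≤N in z , trans (sym (L≗L′ z)) Lz≡k)

  IsLabeling-∘ : ∀ {L : Fin N → ℕ} {σ : Fin N → Fin N} → IsLabeling L →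
                 (∀ {a b} → σ a ≡ σ b → a ≡ b) → (∀ y → Σ (Fin N) λ z → σ z ≡ y) →
                 IsLabeling (L ∘ σ)
  IsLabeling-∘ {L} (inj , bounds , onto) σ-inj σ-onto =
    σ-inj ∘ inj
    , bounds ∘ _
    , λ k 1≤k k≤N → let y , Ly≡k = onto k 1≤k k≤N ; z , σz≡y = σ-onto y
                    in z , trans (cong L σz≡y) Ly≡k

  IsLabeling-rotate : ∀ {L : Fin N → ℕ} → IsLabeling L → IsLabeling (rotate N ∘ L)
  IsLabeling-rotate (inj , bounds , onto) =
    (λ {a} {b} eq → inj (rotate-injective (bounds a) (bounds b) eq))
    , rotate-bounded ∘ bounds
    , λ k 1≤k k≤N → let j , j-bounds , rot-j≡k = rotate-surjective (1≤k , k≤N)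
                        z , Lz≡j = onto j (proj₁ j-bounds) (proj₂ j-bounds)
                    in z , trans (cong (rotate N) Lz≡j) rot-j≡k

  inhabited⇒IsLabeling : ∀ {L : Fin N → ℕ} → (Fin N → IsLabeling L) → IsLabeling L
  inhabited⇒IsLabeling isL =
    (λ {a} → proj₁ (isL a))
    , (λ z → proj₁ (proj₂ (isL z)) z)
    , λ k 1≤k k≤N → proj₂ (proj₂ (isL (fromℕ< (≤-trans 1≤k k≤N)))) k 1≤k k≤N

  labelOne-exists : ∀ {L : Fin N → ℕ} → IsLabeling L → Fin N → Σ (Fin N) λ v → L v ≡ 1
  labelOne-exists (_ , bounds , onto) z = onto 1 ≤-refl (≤-trans (proj₁ (bounds z)) (proj₂ (bounds z)))

  AgreeOutside : (Fin N → Set) → (Fin N → ℕ) → (Fin N → ℕ) → Set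
  AgreeOutside S L L′ = ∀ z → ¬ S z → L z ≡ L′ z

  AgreeOutside-sym : ∀ {S L L′} → AgreeOutside S L L′ → AgreeOutside S L′ L
  AgreeOutside-sym agree z z∉S = sym (agree z z∉S)

  image-agreeOutside : ∀ {S : Fin N → Set} {L L′ : Fin N → ℕ} → U.Decidable S →
    AgreeOutside S L L′ → IsLabeling L → IsLabeling L′ →
    ∀ {k} → Σ (Fin N) (λ y → S y × L y ≡ k) → Σ (Fin N) (λ y → S y × L′ y ≡ k)
  image-agreeOutside S? agree (inj , bounds , _) (_ , _ , onto′) {k} (y , y∈S , Ly≡k)
    with z , L′z≡k ← onto′ k (subst (1 ≤_) Ly≡k (proj₁ (bounds y))) (subst (_≤ N) Ly≡k (proj₂ (bounds y)))
    with S? z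
  ... | yes z∈S = z , z∈S , L′z≡k
  ... | no z∉S with refl ← inj (trans (agree z z∉S) (trans L′z≡k (sym Ly≡k))) = ⊥-elim (z∉S y∈S)

module _ {N : ℕ} (P : FinPoset N) where
  open FinPoset P
  open IsStrictPartialOrder isStrictPartialOrder using () renaming (irrefl to <ₚ-irrefl; trans to <ₚ-trans)

  module _ (L : Fin N → ℕ) where

    argmin-∈ : ∀ ys {w} → argmin P L ys ≡ just w → w ∈ ys
    argmin-∈ (y ∷ ys) eq with argmin P L ys in min≡
    argmin-∈ (y ∷ ys) refl | nothing = here refl
    argmin-∈ (y ∷ ys) eq | just w with L w ℕ.<ᵇ L y
    argmin-∈ (y ∷ ys) refl | just w | true = there (argmin-∈ ys min≡)
    argmin-∈ (y ∷ ys) refl | just w | false = here refl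

    argmin-nothing : ∀ ys → argmin P L ys ≡ nothing → ys ≡ []
    argmin-nothing [] _ = refl
    argmin-nothing (y ∷ ys) eq with argmin P L ys
    argmin-nothing (y ∷ ys) () | nothing
    argmin-nothing (y ∷ ys) eq | just w with L w ℕ.<ᵇ L y
    argmin-nothing (y ∷ ys) () | just w | true
    argmin-nothing (y ∷ ys) () | just w | false

    argmin-minimal : ∀ ys {w y} → argmin P L ys ≡ just w → y ∈ ys → L w ≤ L y
    argmin-minimal (y ∷ ys) eq y∈ with argmin P L ys in min≡
    argmin-minimal (y ∷ ys) refl (here refl) | nothing = ≤-refl
    argmin-minimal (y ∷ ys) refl (there y∈) | nothing with refl ← argmin-nothing ys min≡ = ⊥-elim (∉[] y∈)
    argmin-minimal (y ∷ ys) eq y∈ | just w with L w ℕ.<ᵇ L y | <ᵇ-reflects-< (L w) (L y)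
    argmin-minimal (y ∷ ys) refl (here refl) | just w | true | ofʸ w<y = <⇒≤ w<y
    argmin-minimal (y ∷ ys) refl (there y∈) | just w | true | ofʸ _ = argmin-minimal ys min≡ y∈
    argmin-minimal (y ∷ ys) refl (here refl) | just w | false | ofⁿ _ = ≤-refl
    argmin-minimal (y ∷ ys) refl (there y∈) | just w | false | ofⁿ w≮y =
      ≤-trans (≮⇒≥ w≮y) (argmin-minimal ys min≡ y∈)

  argmin-cong : ∀ {L L′ : Fin N → ℕ} ys → (∀ {y} → y ∈ ys → L y ≡ L′ y) → argmin P L ys ≡ argmin P L′ ys
  argmin-cong [] _ = refl
  argmin-cong {L} {L′} (y ∷ ys) L≡L′ rewrite argmin-cong ys (L≡L′ ∘ there) with argmin P L′ ys in min≡
  ... | nothing = refl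
  ... | just w rewrite L≡L′ (there (argmin-∈ L′ ys min≡)) | L≡L′ {y} (here refl) = refl

  above : Fin N → List (Fin N)
  above v = filterᵇ (λ y → ⌊ v <ₚ? y ⌋) (allFin N)

  ∈-above⁺ : ∀ {v y} → v <ₚ y → y ∈ above v
  ∈-above⁺ {v} {y} = ∈-filterᵇ⁺ (v <ₚ?_) (∈-allFin y)

  ∈-above⁻ : ∀ {v y} → y ∈ above v → v <ₚ y
  ∈-above⁻ {v} = ∈-filterᵇ⁻ (v <ₚ?_) (allFin N)

  #above : Fin N → ℕ
  #above v = length (above v)

  #above-≤ : ∀ v → #above v ≤ N
  #above-≤ v = ≤-trans (length-filter (T? ∘ λ y → ⌊ v <ₚ? y ⌋) (allFin N)) (≤-reflexive (length-tabulate id))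

  #above-< : ∀ {v w} → v <ₚ w → #above w < #above v
  #above-< {v} {w} v<w =
    length-filter-< (T? ∘ λ y → ⌊ w <ₚ? y ⌋) (T? ∘ λ y → ⌊ v <ₚ? y ⌋)
      (λ w<y → fromWitness (<ₚ-trans v<w (toWitness w<y)))
      (∈-allFin w) (fromWitness v<w) (<ₚ-irrefl refl ∘ toWitness)

  Succ : (Fin N → ℕ) → Fin N → Fin N → Set
  Succ L v w = successor P L v ≡ just w

  module _ {L : Fin N → ℕ} where

    Succ-< : ∀ {v w} → Succ L v w → v <ₚ w
    Succ-< {v} s = ∈-above⁻ (argmin-∈ L (above v) s)

    Succ-minimal : ∀ {v w y} → Succ L v w → v <ₚ y → L w ≤ L y
    Succ-minimal {v} s v<y = argmin-minimal L (above v) s (∈-above⁺ v<y)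

    Succ-deterministic : ∀ {v w w′} → Succ L v w → Succ L v w′ → w ≡ w′
    Succ-deterministic s s′ = just-injective (trans (sym s) s′)

    successor-nothing⇒maximal : ∀ {v y} → successor P L v ≡ nothing → ¬ v <ₚ y
    successor-nothing⇒maximal {v} m v<y with () ← subst (_ ∈_) (argmin-nothing L (above v) m) (∈-above⁺ v<y)

  successor-cong : ∀ {L L′ : Fin N → ℕ} v → (∀ {y} → v <ₚ y → L y ≡ L′ y) → successor P L v ≡ successor P L′ v
  successor-cong v L≡L′ = argmin-cong (above v) (L≡L′ ∘ ∈-above⁻)

  inList⇒∈ : ∀ {z} ys → inList P z ys ≡ true → z ∈ ys
  inList⇒∈ {z} (y ∷ ys) eq with z ≟ y
  ... | yes refl = here refl
  ... | no _ = there (inList⇒∈ ys eq)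

  ∈⇒inList : ∀ {z ys} → z ∈ ys → inList P z ys ≡ true
  ∈⇒inList {z} (here {x = y} z≡y) with z ≟ y
  ... | yes _ = refl
  ... | no z≢y = ⊥-elim (z≢y z≡y)
  ∈⇒inList {z} (there {x = y} z∈) with z ≟ y
  ... | yes _ = refl
  ... | no _ = ∈⇒inList z∈

  Reach : (Fin N → ℕ) → Fin N → Fin N → Set
  Reach L = Star (Succ L)

  module _ {L : Fin N → ℕ} where

    Reach-Succ-< : ∀ {v z w} → Reach L v z → Succ L z w → v <ₚ w
    Reach-Succ-< ε s = Succ-< s
    Reach-Succ-< (s′ ◅ r) s = <ₚ-trans (Succ-< s′) (Reach-Succ-< r s)

    Reach-last : ∀ {v z} → Reach L v z → v ≡ z ⊎ Σ (Fin N) λ p → Reach L v p × Succ L p z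
    Reach-last ε = inj₁ refl
    Reach-last {v} (s ◅ r) with Reach-last r
    ... | inj₁ refl = inj₂ (v , ε , s)
    ... | inj₂ (p , v→p , p→z) = inj₂ (p , s ◅ v→p , p→z)

    Reach-total : ∀ {v a b} → Reach L v a → Reach L v b → Reach L a b ⊎ Reach L b a
    Reach-total ε v→b = inj₁ v→b
    Reach-total v→a ε = inj₂ v→a
    Reach-total (s ◅ w→a) (s′ ◅ w′→b) with refl ← Succ-deterministic s s′ = Reach-total w→a w′→b

    Reach-from-maximal : ∀ {a b} → successor P L a ≡ nothing → Reach L a b → a ≡ b
    Reach-from-maximal _ ε = refl
    Reach-from-maximal m (s ◅ _) with () ← trans (sym m) s

    Reach-into-Succ : ∀ {a b w} → Succ L a w → Reach L a b → Succ L b w → a ≡ b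
    Reach-into-Succ _ ε _ = refl
    Reach-into-Succ a→w (s ◅ r) b→w with refl ← Succ-deterministic s a→w =
      ⊥-elim (<ₚ-irrefl refl (Reach-Succ-< r b→w))

    Reach-maximal-within : ∀ k v → #above v < k → Σ (Fin N) λ e → Reach L v e × successor P L e ≡ nothing
    Reach-maximal-within (suc k) v bound with successor P L v in s
    ... | nothing = v , ε , s
    ... | just w with e , w→e , m ← Reach-maximal-within k w (<-≤-trans (#above-< (Succ-< s)) (≤-pred bound)) =
      e , s ◅ w→e , m

    Reach-maximal : ∀ v → Σ (Fin N) λ e → Reach L v e × successor P L e ≡ nothing
    Reach-maximal v = Reach-maximal-within (suc (#above v)) v ≤-refl

    chainFrom-head : ∀ k v → v ∈ chainFrom P L k v
    chainFrom-head zero v = here refl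
    chainFrom-head (suc k) v with successor P L v
    ... | nothing = here refl
    ... | just _ = here refl

    chainFrom-sound : ∀ {k v z} → z ∈ chainFrom P L k v → Reach L v z
    chainFrom-sound {zero} (here refl) = ε
    chainFrom-sound {suc k} {v} z∈ with successor P L v in s
    chainFrom-sound (here refl) | nothing = ε
    chainFrom-sound (here refl) | just w = ε
    chainFrom-sound {suc k} (there z∈) | just w = s ◅ chainFrom-sound {k} z∈

    -- #above decreases strictly along the chain, so the fuel N used by promotionChain suffices.
    chainFrom-complete : ∀ {k v z} → Reach L v z → #above v ≤ k → z ∈ chainFrom P L k v
    chainFrom-complete {k} {v} ε _ = chainFrom-head k v
    chainFrom-complete {zero} (s ◅ _) bound = ⊥-elim (n≮0 (<-≤-trans (#above-< (Succ-< s)) bound))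
    chainFrom-complete {suc k} (s ◅ r) bound rewrite s =
      there (chainFrom-complete r (≤-pred (<-≤-trans (#above-< (Succ-< s)) bound)))

    labelOne-unique : ∀ {u} → (∀ {a b} → L a ≡ L b → a ≡ b) → L u ≡ 1 → labelOne P L ≡ just u
    labelOne-unique {u} inj Lu≡1 with labelOne P L in eq
    ... | nothing
      with () ← subst (u ∈_) (argmin-nothing L _ eq) (∈-filterᵇ⁺ (λ y → L y ℕ.≟ 1) (∈-allFin u) Lu≡1)
    ... | just u′ =
      cong just (inj (trans (∈-filterᵇ⁻ (λ y → L y ℕ.≟ 1) (allFin N) (argmin-∈ L _ eq)) (sym Lu≡1)))

  module PromotionChain {L : Fin N → ℕ} (isL : IsLabeling L) {v₁ : Fin N} (Lv₁≡1 : L v₁ ≡ 1) where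

    OnChain : Fin N → Set
    OnChain = Reach L v₁

    onChain⇒inList : ∀ {z} → OnChain z → inList P z (promotionChain P L) ≡ true
    onChain⇒inList c rewrite labelOne-unique (proj₁ isL) Lv₁≡1 = ∈⇒inList (chainFrom-complete c (#above-≤ v₁))

    inList⇒onChain : ∀ {z} → inList P z (promotionChain P L) ≡ true → OnChain z
    inList⇒onChain eq rewrite labelOne-unique (proj₁ isL) Lv₁≡1 = chainFrom-sound {k = N} (inList⇒∈ _ eq)

    notOnChain⇒inList : ∀ {z} → ¬ OnChain z → inList P z (promotionChain P L) ≡ false
    notOnChain⇒inList {z} ¬c with inList P z (promotionChain P L) in eq
    ... | true = ⊥-elim (¬c (inList⇒onChain eq))
    ... | false = refl

    data Position (z : Fin N) : Set where
      off   : ¬ OnChain z → Position z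
      inner : ∀ {w} → OnChain z → Succ L z w → Position z
      final : OnChain z → successor P L z ≡ nothing → Position z

    position : ∀ z → Position z
    position z with inList P z (promotionChain P L) in eq | successor P L z in s
    ... | false | _ = off λ c → case trans (sym (onChain⇒inList c)) eq of λ ()
    ... | true | just w = inner (inList⇒onChain eq) s
    ... | true | nothing = final (inList⇒onChain eq) s

    promotion-off : ∀ {z} → ¬ OnChain z → promotion P L z ≡ L z ∸ 1
    promotion-off ¬c rewrite notOnChain⇒inList ¬c = refl

    promotion-inner : ∀ {z w} → OnChain z → Succ L z w → promotion P L z ≡ L w ∸ 1
    promotion-inner c s rewrite onChain⇒inList c | s = refl

    promotion-final : ∀ {z} → OnChain z → successor P L z ≡ nothing → promotion P L z ≡ N
    promotion-final c m rewrite onChain⇒inList c | m = refl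

    chainShift : Fin N → Fin N
    chainShift z with position z
    ... | off _ = z
    ... | inner {w} _ _ = w
    ... | final _ _ = v₁

    Succ-≢v₁ : ∀ {z w} → OnChain z → Succ L z w → w ≢ v₁
    Succ-≢v₁ c s refl = <ₚ-irrefl refl (Reach-Succ-< c s)

    label-≢1 : ∀ {z} → z ≢ v₁ → L z ≢ 1
    label-≢1 z≢v₁ Lz≡1 = z≢v₁ (proj₁ isL (trans Lz≡1 (sym Lv₁≡1)))

    promotion≡rotate∘chainShift : ∀ z → promotion P L z ≡ rotate N (L (chainShift z))
    promotion≡rotate∘chainShift z with position z
    ... | off ¬c = trans (promotion-off ¬c) (sym (rotate-≢1 N (label-≢1 λ { refl → ¬c ε })))
    ... | inner c s = trans (promotion-inner c s) (sym (rotate-≢1 N (label-≢1 (Succ-≢v₁ c s))))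
    ... | final c m = trans (promotion-final c m) (sym (cong (rotate N) Lv₁≡1))

    chainShift-off : ∀ {z} → ¬ OnChain z → chainShift z ≡ z
    chainShift-off {z} ¬c with position z
    ... | off _ = refl
    ... | inner c _ = ⊥-elim (¬c c)
    ... | final c _ = ⊥-elim (¬c c)

    chainShift-inner : ∀ {z w} → OnChain z → Succ L z w → chainShift z ≡ w
    chainShift-inner {z} c s with position z
    ... | off ¬c = ⊥-elim (¬c c)
    ... | inner _ s′ = Succ-deterministic s′ s
    ... | final _ m with () ← trans (sym m) s

    chainShift-final : ∀ {z} → OnChain z → successor P L z ≡ nothing → chainShift z ≡ v₁
    chainShift-final {z} c m with position z
    ... | off ¬c = ⊥-elim (¬c c)
    ... | inner _ s with () ← trans (sym m) s
    ... | final _ _ = refl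

    chainShift-injective : ∀ {a b} → chainShift a ≡ chainShift b → a ≡ b
    chainShift-injective {a} {b} eq with position a | position b
    ... | off _     | off _     = eq
    ... | off ¬ca   | inner cb s = ⊥-elim (¬ca (subst OnChain (sym eq) (cb ◅◅ s ◅ ε)))
    ... | off ¬ca   | final _ _ = ⊥-elim (¬ca (subst OnChain (sym eq) ε))
    ... | inner ca s | off ¬cb  = ⊥-elim (¬cb (subst OnChain eq (ca ◅◅ s ◅ ε)))
    ... | final _ _ | off ¬cb   = ⊥-elim (¬cb (subst OnChain eq ε))
    ... | inner ca s | inner cb s′ with refl ← eq with Reach-total ca cb
    ...   | inj₁ a→b = Reach-into-Succ s a→b s′
    ...   | inj₂ b→a = sym (Reach-into-Succ s′ b→a s)
    chainShift-injective eq | inner ca s | final _ _ = ⊥-elim (Succ-≢v₁ ca s eq)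
    chainShift-injective eq | final _ _ | inner cb s = ⊥-elim (Succ-≢v₁ cb s (sym eq))
    chainShift-injective eq | final ca ma | final cb mb with Reach-total ca cb
    ... | inj₁ a→b = Reach-from-maximal ma a→b
    ... | inj₂ b→a = sym (Reach-from-maximal mb b→a)

    chainShift-onto-chain : ∀ {y} → OnChain y → Σ (Fin N) λ z → chainShift z ≡ y
    chainShift-onto-chain c with Reach-last c
    ... | inj₁ refl = let e , v₁→e , m = Reach-maximal v₁ in e , chainShift-final v₁→e m
    ... | inj₂ (p , v₁→p , p→y) = p , chainShift-inner v₁→p p→y

    chainShift-surjective : ∀ y → Σ (Fin N) λ z → chainShift z ≡ y
    chainShift-surjective y with position y
    ... | off ¬c = y , chainShift-off ¬c
    ... | inner c _ = chainShift-onto-chain c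
    ... | final c _ = chainShift-onto-chain c

    promotion-isLabeling : IsLabeling (promotion P L)
    promotion-isLabeling =
      IsLabeling-resp-≗ (sym ∘ promotion≡rotate∘chainShift)
        (IsLabeling-rotate (IsLabeling-∘ isL chainShift-injective chainShift-surjective))

  promotion-isLabeling : ∀ {L} → IsLabeling L → IsLabeling (promotion P L)
  promotion-isLabeling isL = inhabited⇒IsLabeling λ z →
    PromotionChain.promotion-isLabeling isL (proj₂ (labelOne-exists isL z))

  promotion^-isLabeling : ∀ γ {L} → IsLabeling L → IsLabeling (promotion^ P γ L)
  promotion^-isLabeling zero = id
  promotion^-isLabeling (suc γ) = promotion-isLabeling ∘ promotion^-isLabeling γ

  module _ (x : Fin N) (hyp : ∀ y z → z <ₚ x → Comparable P y z → Comparable P y x) where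

    ¬below-upward : ∀ {z y} → ¬ z <ₚ x → z <ₚ y → ¬ y <ₚ x
    ¬below-upward ¬z<x z<y y<x = ¬z<x (<ₚ-trans z<y y<x)

    -- The only use of the hypothesis: y is comparable with v <ₚ x, hence with x, hence above x.
    above-below-transfer : ∀ {v v′ y} → v <ₚ x → v′ <ₚ x → ¬ y <ₚ x → v <ₚ y → v′ <ₚ y
    above-below-transfer v<x v′<x ¬y<x v<y with hyp _ _ v<x (inj₂ (inj₂ v<y))
    ... | inj₁ refl = v′<x
    ... | inj₂ (inj₁ y<x) = ⊥-elim (¬y<x y<x)
    ... | inj₂ (inj₂ x<y) = <ₚ-trans v′<x x<y

    module _ {L L′ : Fin N → ℕ} (agree : AgreeOutside (_<ₚ x) L L′) where

      successor-agreeOutside : ∀ {z} → ¬ z <ₚ x → successor P L z ≡ successor P L′ z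
      successor-agreeOutside {z} ¬z<x = successor-cong z λ z<y → agree _ (¬below-upward ¬z<x z<y)

      Reach-agreeOutside : ∀ {v z} → ¬ v <ₚ x → Reach L v z → Reach L′ v z
      Reach-agreeOutside _ ε = ε
      Reach-agreeOutside ¬v<x (s ◅ r) =
        trans (sym (successor-agreeOutside ¬v<x)) s ◅ Reach-agreeOutside (¬below-upward ¬v<x (Succ-< s)) r

      exit-unique : (∀ {a b} → L a ≡ L b → a ≡ b) → ∀ {v v′ w w′} → v <ₚ x → v′ <ₚ x →
                    Succ L v w → ¬ w <ₚ x → Succ L′ v′ w′ → ¬ w′ <ₚ x → w ≡ w′
      exit-unique inj {w = w} {w′} v<x v′<x s ¬w<x s′ ¬w′<x = inj (≤-antisym Lw≤Lw′ Lw′≤Lw)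
        where
          Lw≤Lw′ : L w ≤ L w′
          Lw≤Lw′ = Succ-minimal s (above-below-transfer v′<x v<x ¬w′<x (Succ-< s′))
          Lw′≤Lw : L w′ ≤ L w
          Lw′≤Lw = subst₂ _≤_ (sym (agree w′ ¬w′<x)) (sym (agree w ¬w<x))
                     (Succ-minimal s′ (above-below-transfer v<x v′<x ¬w<x (Succ-< s)))

    Reach-exit : ∀ {L v e} → Reach L v e → v <ₚ x → ¬ e <ₚ x →
      Σ (Fin N) λ p → Σ (Fin N) λ w → Reach L v p × p <ₚ x × Succ L p w × ¬ w <ₚ x × Reach L w e
    Reach-exit ε v<x ¬v<x = ⊥-elim (¬v<x v<x)
    Reach-exit {v = v} (_◅_ {j = w} s r) v<x ¬e<x with w <ₚ? x
    ... | no ¬w<x = v , w , ε , v<x , s , ¬w<x , r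
    ... | yes w<x with p , w′ , w→p , rest ← Reach-exit r w<x ¬e<x = p , w′ , s ◅ w→p , rest

    Reach-cross : ∀ {L L′} → AgreeOutside (_<ₚ x) L L′ → (∀ {a b} → L a ≡ L b → a ≡ b) →
                  ∀ {v v′ z} → v <ₚ x → v′ <ₚ x → ¬ z <ₚ x → Reach L v z → Reach L′ v′ z
    Reach-cross {L′ = L′} agree inj {v′ = v′} v<x v′<x ¬z<x v→z
      with p , w , _ , p<x , s , ¬w<x , w→z ← Reach-exit v→z v<x ¬z<x
         | e′ , v′→e′ , m′ ← Reach-maximal {L′} v′
      with p′ , w′ , v′→p′ , p′<x , s′ , ¬w′<x , _ ← Reach-exit v′→e′ v′<x (successor-nothing⇒maximal m′)
      with refl ← exit-unique agree inj p<x p′<x s ¬w<x s′ ¬w′<x =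
      v′→p′ ◅◅ s′ ◅ Reach-agreeOutside agree ¬w<x w→z

    onChain-agreeOutside : ∀ {L L′} → AgreeOutside (_<ₚ x) L L′ → IsLabeling L → IsLabeling L′ →
      ∀ {v₁ v₁′ z} → L v₁ ≡ 1 → L′ v₁′ ≡ 1 → ¬ z <ₚ x → Reach L v₁ z → Reach L′ v₁′ z
    onChain-agreeOutside agree (inj , _) (inj′ , _) {v₁} {v₁′} Lv₁≡1 L′v₁′≡1 ¬z<x v₁→z
      with v₁ <ₚ? x | v₁′ <ₚ? x
    ... | yes v₁<x | yes v₁′<x = Reach-cross agree inj v₁<x v₁′<x ¬z<x v₁→z
    ... | no ¬v₁<x | _ with refl ← inj′ (trans L′v₁′≡1 (trans (sym Lv₁≡1) (agree v₁ ¬v₁<x))) =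
      Reach-agreeOutside agree ¬v₁<x v₁→z
    ... | yes v₁<x | no ¬v₁′<x with refl ← inj (trans Lv₁≡1 (trans (sym L′v₁′≡1) (sym (agree v₁′ ¬v₁′<x)))) =
      ⊥-elim (¬v₁′<x v₁<x)

    module _ {L L′} (isL : IsLabeling L) (isL′ : IsLabeling L′) (agree : AgreeOutside (_<ₚ x) L L′)
             {v₁ v₁′} (Lv₁≡1 : L v₁ ≡ 1) (L′v₁′≡1 : L′ v₁′ ≡ 1) where
      private
        module C = PromotionChain isL Lv₁≡1
        module C′ = PromotionChain isL′ L′v₁′≡1
      open ≡-Reasoning

      onChain-to : ∀ {z} → ¬ z <ₚ x → C.OnChain z → C′.OnChain z
      onChain-to = onChain-agreeOutside agree isL isL′ Lv₁≡1 L′v₁′≡1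

      onChain-from : ∀ {z} → ¬ z <ₚ x → C′.OnChain z → C.OnChain z
      onChain-from = onChain-agreeOutside (AgreeOutside-sym agree) isL′ isL L′v₁′≡1 Lv₁≡1

      promotion-agreeOutside-at : AgreeOutside (_<ₚ x) (promotion P L) (promotion P L′)
      promotion-agreeOutside-at z ¬z<x with C.position z
      ... | C.off ¬c = begin
        promotion P L z   ≡⟨ C.promotion-off ¬c ⟩
        L z ∸ 1           ≡⟨ cong (_∸ 1) (agree z ¬z<x) ⟩
        L′ z ∸ 1          ≡⟨ C′.promotion-off (¬c ∘ onChain-from ¬z<x) ⟨
        promotion P L′ z  ∎
      ... | C.inner {w} c s = begin
        promotion P L z   ≡⟨ C.promotion-inner c s ⟩
        L w ∸ 1           ≡⟨ cong (_∸ 1) (agree w (¬below-upward ¬z<x (Succ-< s))) ⟩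
        L′ w ∸ 1          ≡⟨ C′.promotion-inner (onChain-to ¬z<x c) (trans (sym (successor-agreeOutside agree ¬z<x)) s) ⟨
        promotion P L′ z  ∎
      ... | C.final c m = begin
        promotion P L z   ≡⟨ C.promotion-final c m ⟩
        N                 ≡⟨ C′.promotion-final (onChain-to ¬z<x c) (trans (sym (successor-agreeOutside agree ¬z<x)) m) ⟨
        promotion P L′ z  ∎

    promotion-agreeOutside : ∀ {L L′} → IsLabeling L → IsLabeling L′ → AgreeOutside (_<ₚ x) L L′ →
                             AgreeOutside (_<ₚ x) (promotion P L) (promotion P L′)
    promotion-agreeOutside isL isL′ agree z = promotion-agreeOutside-at isL isL′ agree
      (proj₂ (labelOne-exists isL z)) (proj₂ (labelOne-exists isL′ z)) z

    promotion^-agreeOutside : ∀ γ {L L′} → IsLabeling L → IsLabeling L′ → AgreeOutside (_<ₚ x) L L′ →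
                              AgreeOutside (_<ₚ x) (promotion^ P γ L) (promotion^ P γ L′)
    promotion^-agreeOutside zero _ _ agree = agree
    promotion^-agreeOutside (suc γ) isL isL′ agree =
      promotion-agreeOutside (promotion^-isLabeling γ isL) (promotion^-isLabeling γ isL′)
        (promotion^-agreeOutside γ isL isL′ agree)

lemma3p10 : ∀ {N : ℕ} (P : FinPoset N) (x : Fin N) →
    (∀ y z → FinPoset._<ₚ_ P z x → Comparable P y z → Comparable P y x) →
    ∀ (L L̃ : Fin N → ℕ) → IsLabeling L → IsLabeling L̃ →
    (∀ z → ¬X P x z → L̃ z ≡ L z) →
    ∀ (γ : ℕ) (k : ℕ) →
      (Σ (Fin N) λ y → FinPoset._<ₚ_ P y x × promotion^ P γ L̃ y ≡ k)
      ⇔ (Σ (Fin N) λ y → FinPoset._<ₚ_ P y x × promotion^ P γ L y ≡ k)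
lemma3p10 P x hyp L L̃ isL isL̃ agree γ _ =
  mk⇔ (image-agreeOutside below? agreeγ isL̃γ isLγ)
      (image-agreeOutside below? (AgreeOutside-sym agreeγ) isLγ isL̃γ)
  where
    open FinPoset P using (_<ₚ_; _<ₚ?_)
    below? : U.Decidable (_<ₚ x)
    below? z = z <ₚ? x
    isLγ : IsLabeling (promotion^ P γ L)
    isLγ = promotion^-isLabeling P γ isL
    isL̃γ : IsLabeling (promotion^ P γ L̃)
    isL̃γ = promotion^-isLabeling P γ isL̃
    agreeγ : AgreeOutside (_<ₚ x) (promotion^ P γ L̃) (promotion^ P γ L)
    agreeγ = promotion^-agreeOutside P x hyp γ isL̃ isL agree
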